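{- Let $T$ be a tree, $f$ and $f_t$ token-placements of $T$ with colors $\{1,2\}$ having the same number of vertices of color $1$, and let $D=\sum_{e\in E(T)}\mathrm{diff}(e)$ (computed with respect to $f$ and $f_t$). If $D\ne0$, then there exists an edge $e$ of $T$ such that swapping the tokens on the endpoints of $e$ (producing a new placement $f'$) decreases $D$ by one, i.e. $D$ computed for $f'$ and $f_t$ equals $D-1$.
   Context: A token-placement is a surjective map $V(T)\to\{1,2\}$. Swapping along an edge $(x,y)$ exchanges the values at $x$ and $y$. For an edge $e=(x,y)$ of $T$, removing $e$ splits $T$ into the subtree $T(x)$ containing $x$ and $T(y)$ containing $y$; let $n^1(f)$ and $n^1(f_t)$ be the numbers of vertices of $T(x)$ with color $1$ under $f$ and $f_t$, respectively, and define $\mathrm{diff}(e)=|n^1(f)-n^1(f_t)|$ (this value does not depend on which side is used, since the total numbers of color-1 vertices agree). -}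

module Defs where

open import Data.Nat using (ℕ; zero; suc; _+_; ∣_-_∣)
open import Data.Bool using (Bool; true; false; _∧_; _∨_; if_then_else_)
open import Data.Fin using (Fin; zero; suc)
open import Data.Fin.Properties using (_≟_)
open import Data.List using (List; []; _∷_; length; map; allFin; removeAt; lookup)
open import Data.Nat.ListAction using (sum)
open import Data.Bool.ListAction using (any)
open import Data.List.Membership.Propositional using (_∈_)
open import Data.Product using (_×_; _,_; ∃)
open import Relation.Binary.PropositionalEquality using (_≡_)
open import Relation.Nullary.Decidable using (⌊_⌋)

-- Undirected edges on vertex set Fin n, given as (unordered) pairs.
Edge : ℕ → Set
Edge n = Fin n × Fin n

data Walk {n : ℕ} (E : List (Edge n)) : Fin n → Fin n → Set where
  here  : ∀ {u} → Walk E u u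
  fwd   : ∀ {u v w} → (u , v) ∈ E → Walk E v w → Walk E u w
  bwd   : ∀ {u v w} → (v , u) ∈ E → Walk E v w → Walk E u w

record Tree (n : ℕ) : Set where
  field
    edges     : List (Edge n)
    connected : ∀ u v → Walk edges u v
    size      : suc (length edges) ≡ n
open Tree public

-- Colours {1,2} are represented by Fin 2: colour 1 = zero, colour 2 = suc zero.
Coloring : ℕ → Set
Coloring n = Fin n → Fin 2

IsPlacement : ∀ {n} → Coloring n → Set
IsPlacement {n} f = ∀ (c : Fin 2) → ∃ λ (v : Fin n) → f v ≡ c

isColor1 : Fin 2 → Bool
isColor1 zero    = true
isColor1 (suc _) = false

_==_ : ∀ {n} → Fin n → Fin n → Bool
x == y = ⌊ x ≟ y ⌋

reach : ∀ {n} → List (Edge n) → ℕ → Fin n → Fin n → Bool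
reach E zero    u v = u == v
reach E (suc k) u v =
  (u == v) ∨ any (λ { (a , b) → ((a == u) ∧ reach E k b v) ∨ ((b == u) ∧ reach E k a v) }) E

count1In : ∀ {n} → (Fin n → Bool) → Coloring n → ℕ
count1In {n} S f = sum (map (λ v → if S v ∧ isColor1 (f v) then 1 else 0) (allFin n))

count1 : ∀ {n} → Coloring n → ℕ
count1 f = count1In (λ _ → true) f

-- For the i-th edge e = (x,y): T(x) is the component of x in T - e
-- (every vertex reachable from x by a walk of ≤ n edges avoiding e; simple paths have < n edges).
side : ∀ {n} (T : Tree n) → Fin (length (edges T)) → Fin n → Bool
side {n} T i with lookup (edges T) i
... | (x , y) = reach (removeAt (edges T) i) n x

diff : ∀ {n} (T : Tree n) → Fin (length (edges T)) → Coloring n → Coloring n → ℕ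
diff T i f ft = ∣ count1In (side T i) f - count1In (side T i) ft ∣

D : ∀ {n} (T : Tree n) → Coloring n → Coloring n → ℕ
D T f ft = sum (map (λ i → diff T i f ft) (allFin (length (edges T))))

swap : ∀ {n} → Coloring n → Fin n → Fin n → Coloring n
swap f x y v = if v == x then f y else (if v == y then f x else f v)

swapAlong : ∀ {n} (T : Tree n) → Fin (length (edges T)) → Coloring n → Coloring n
swapAlong T i f with lookup (edges T) i
... | (x , y) = swap f x y

-- Orient an edge e from t to w and call it excessive when f has more colour-1 tokens than f_t
-- on the side of t.  Swapping along an excessive edge with f t = 1 and f w = 2 leaves diff
-- unchanged on every other edge (both endpoints of e lie on the same side of it) and lowers
-- diff e by one.  If D ≠ 0, some edge is excessive.  While its tail has colour 2, the excess
-- on the tail's side lies beyond another edge at the tail, which is excessive towards it; while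
-- its head has colour 1, the deficit on the head's side lies beyond another edge at the head,
-- which is excessive away from it.  Each move strictly shrinks the side being searched.
module Submission where

open import Defs
open import Level using (0ℓ)
open import Data.Bool using (Bool; true; false; T; not; _∧_; _∨_; if_then_else_)
open import Data.Bool.Properties using (T-∨; T-∧; T-≡; T?; not-involutive)
open import Data.Fin using (Fin; zero; suc)
open import Data.Fin.Properties using (_≟_; any?; injective⇒≤; suc-injective)
open import Data.List using (List; []; _∷_; [_]; length; lookup; map; allFin; tabulate; removeAt)
open import Data.List.Properties using (map-tabulate; length-removeAt′)
open import Data.List.Membership.Propositional using (_∈_; find; lose)
open import Data.List.Membership.Propositional.Properties using (∈-lookup)
import Data.List.Membership.DecPropositional as DecMembership
open import Data.List.Relation.Unary.All as All using (All; _∷_)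
open import Data.List.Relation.Unary.All.Properties.Core using (¬Any⇒All¬)
open import Data.List.Relation.Unary.Any using (here; there; index)
open import Data.List.Relation.Unary.Any.Properties using (any⁺; any⁻; lookup-index)
open import Data.List.Relation.Unary.Unique.Propositional using (Unique; []; _∷_)
open import Data.Nat using (ℕ; zero; suc; _+_; _≤_; _<_; z≤n; s≤s; ∣_-_∣)
open import Data.Nat.Induction using (<-wellFounded)
open import Data.Nat.ListAction using () renaming (sum to listSum)
open import Data.Nat.Properties
  using ( +-0-commutativeMonoid; +-comm; +-suc; +-identityʳ; +-cancelʳ-≡; +-cancelˡ-≤
        ; +-mono-≤; +-monoˡ-≤; +-monoʳ-≤; +-mono-<-≤; +-mono-≤-<
        ; ≤-refl; ≤-reflexive; ≤-trans; ≤-pred; n≤1+n; m≤n⇒m≤1+n; <⇒≤; <-irrefl; <-asym; <-cmp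
        ; _<?_; <⇒≱; ≮⇒≥; ≰⇒>; n≢0⇒n>0; m≡n⇒∣m-n∣≡0; module ≤-Reasoning )
open import Algebra.Properties.CommutativeMonoid.Sum +-0-commutativeMonoid
  using (sum-cong-≗; sum-replicate-zero; ∑-distrib-+; ∑-comm) renaming (sum to ∑)
open import Data.Nat.Solver using (module +-*-Solver)
open import Data.Product using (Σ; ∃; _×_; _,_; proj₁; proj₂)
open import Data.Sum as Sum using (_⊎_; inj₁; inj₂)
open import Data.Unit using (⊤; tt)
open import Function using (Equivalence; _∘_; case_of_)
open import Induction.WellFounded using (Acc; acc)
open import Relation.Binary using (Rel; tri<; tri≈; tri>)
open import Relation.Binary.Construct.Closure.ReflexiveTransitive as Star
  using (Star; ε; _◅_; _◅◅_; _⋆; return; reverse)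
open import Relation.Binary.PropositionalEquality
  using (_≡_; _≢_; refl; sym; trans; cong; cong₂; subst; subst₂; module ≡-Reasoning)
open import Relation.Nullary using (¬_; yes; no; contradiction)
open import Relation.Nullary.Decidable using (_×-dec_; dec-true; dec-false; isYes≗does; toWitness; fromWitness)

open Equivalence using (to; from)
open +-*-Solver using (solve; _:+_; _:=_)

==-refl : ∀ {n} (x : Fin n) → (x == x) ≡ true
==-refl x = trans (isYes≗does (x ≟ x)) (dec-true (x ≟ x) refl)

==-≢ : ∀ {n} {x y : Fin n} → x ≢ y → (x == y) ≡ false
==-≢ {x = x} {y} x≢y = trans (isYes≗does (x ≟ y)) (dec-false (x ≟ y) x≢y)

listSum-allFin : ∀ {n} (c : Fin n → ℕ) → listSum (map c (allFin n)) ≡ ∑ c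
listSum-allFin {n} c = trans (cong listSum (map-tabulate {n = n} (λ i → i) c)) (listSum-tabulate c)
  where
  listSum-tabulate : ∀ {k} (g : Fin k → ℕ) → listSum (tabulate g) ≡ ∑ g
  listSum-tabulate {zero}  g = refl
  listSum-tabulate {suc k} g = cong (g zero +_) (listSum-tabulate (λ i → g (suc i)))

∑-zero : ∀ {n} {c : Fin n → ℕ} → (∀ v → c v ≡ 0) → ∑ c ≡ 0
∑-zero {n} z = trans (sum-cong-≗ z) (sum-replicate-zero n)

∑-single : ∀ {n} {c : Fin n → ℕ} x → (∀ v → v ≢ x → c v ≡ 0) → ∑ c ≡ c x
∑-single {suc n} {c} zero    z = trans (cong (c zero +_) (∑-zero (λ v → z (suc v) λ ()))) (+-identityʳ _)
∑-single {suc n} {c} (suc x) z =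
  trans (cong (_+ ∑ (λ v → c (suc v))) (z zero λ ()))
        (∑-single x (λ v v≢x → z (suc v) λ { refl → v≢x refl }))

∑-mono-≤ : ∀ {n} {a b : Fin n → ℕ} → (∀ v → a v ≤ b v) → ∑ a ≤ ∑ b
∑-mono-≤ {zero}  le = z≤n
∑-mono-≤ {suc n} le = +-mono-≤ (le zero) (∑-mono-≤ (λ v → le (suc v)))

∑-mono-< : ∀ {n} {a b : Fin n → ℕ} → (∀ v → a v ≤ b v) → ∀ x → a x < b x → ∑ a < ∑ b
∑-mono-< le zero    lt = +-mono-<-≤ lt (∑-mono-≤ (λ v → le (suc v)))
∑-mono-< le (suc x) lt = +-mono-≤-< (le zero) (∑-mono-< (λ v → le (suc v)) x lt)

∑-<⇒∃< : ∀ {n} {a b : Fin n → ℕ} → ∑ a < ∑ b → ∃ λ k → a k < b k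
∑-<⇒∃< {a = a} {b} ∑a<∑b with any? (λ k → a k <? b k)
... | yes found = found
... | no  none  = contradiction (∑-mono-≤ (λ k → ≮⇒≥ (none ∘ (k ,_)))) (<⇒≱ ∑a<∑b)

∑-pick : ∀ {n} (c : Fin n → ℕ) x → ∑ c ≡ c x + ∑ (λ v → if v == x then 0 else c v)
∑-pick c x = begin
  ∑ c                      ≡⟨ sum-cong-≗ split ⟩
  ∑ (λ v → at v + rest v)  ≡⟨ ∑-distrib-+ at rest ⟩
  ∑ at + ∑ rest            ≡⟨ cong (_+ ∑ rest) (∑-single x λ v v≢x → cong (if_then c v else 0) (==-≢ v≢x)) ⟩
  at x + ∑ rest            ≡⟨ cong (λ b → (if b then c x else 0) + ∑ rest) (==-refl x) ⟩
  c x + ∑ rest             ∎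
  where
  at rest : Fin _ → ℕ
  at   v = if v == x then c v else 0
  rest v = if v == x then 0 else c v
  open ≡-Reasoning
  split : ∀ v → c v ≡ at v + rest v
  split v with v == x
  ... | true  = sym (+-identityʳ _)
  ... | false = refl

∑-≤⇒∃< : ∀ {n} {a b : Fin n → ℕ} j → ∑ a ≤ ∑ b → b j < a j → ∃ λ k → a k < b k
∑-≤⇒∃< {a = a} {b} j ∑a≤∑b bⱼ<aⱼ with any? (λ k → a k <? b k)
... | yes found = found
... | no  none  = contradiction ∑a≤∑b (<⇒≱ (∑-mono-< (λ k → ≮⇒≥ (none ∘ (k ,_))) j bⱼ<aⱼ))

sumOn : ∀ {n} → (Fin n → Bool) → (Fin n → ℕ) → ℕ
sumOn P c = ∑ (λ v → if P v then c v else 0)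

card : ∀ {n} → (Fin n → Bool) → ℕ
card P = sumOn P (λ _ → 1)

sumOn-complement : ∀ {n} (P Q : Fin n → Bool) (c : Fin n → ℕ) → (∀ v → Q v ≡ not (P v)) →
                   sumOn P c + sumOn Q c ≡ ∑ c
sumOn-complement P Q c Q≡¬P =
  trans (sym (∑-distrib-+ (λ v → if P v then c v else 0) (λ v → if Q v then c v else 0))) (sum-cong-≗ pointwise)
  where
  pointwise : ∀ v → (if P v then c v else 0) + (if Q v then c v else 0) ≡ c v
  pointwise v rewrite Q≡¬P v with P v
  ... | true  = +-identityʳ (c v)
  ... | false = refl

sumOn-<⇒∃ : ∀ {n} {P : Fin n → Bool} {c d : Fin n → ℕ} → sumOn P c < sumOn P d → ∃ λ v → P v ≡ true
sumOn-<⇒∃ {P = P} lt with v , lt-v ← ∑-<⇒∃< lt with P v in Pv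
... | true  = v , Pv
... | false = contradiction lt-v λ ()

private
  ∑-rest-cong : ∀ {n} {a b : Fin n → ℕ} x → (∀ v → v ≢ x → a v ≡ b v) →
                ∑ (λ v → if v == x then 0 else a v) ≡ ∑ (λ v → if v == x then 0 else b v)
  ∑-rest-cong {a = a} {b} x a≡b = sum-cong-≗ pointwise
    where
    pointwise : ∀ v → (if v == x then 0 else a v) ≡ (if v == x then 0 else b v)
    pointwise v with v ≟ x
    ... | yes _   = refl
    ... | no v≢x = a≡b v v≢x

∑-suc-at : ∀ {n} {a b : Fin n → ℕ} j → (∀ i → i ≢ j → a i ≡ b i) → suc (a j) ≡ b j →
           suc (∑ a) ≡ ∑ b
∑-suc-at {a = a} {b} j a≡b sucaⱼ≡bⱼ = begin
  suc (∑ a)                                  ≡⟨ cong suc (∑-pick a j) ⟩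
  suc (a j) + ∑ (λ v → if v == j then 0 else a v) ≡⟨ cong₂ _+_ sucaⱼ≡bⱼ (∑-rest-cong j a≡b) ⟩
  b j + ∑ (λ v → if v == j then 0 else b v)   ≡⟨ ∑-pick b j ⟨
  ∑ b                                        ∎
  where open ≡-Reasoning

∑-exchange : ∀ {n} {a b : Fin n → ℕ} {x y} → x ≢ y → (∀ v → v ≢ x → v ≢ y → a v ≡ b v) →
             ∑ a + (b x + b y) ≡ ∑ b + (a x + a y)
∑-exchange {a = a} {b} {x} {y} x≢y a≡b = begin
  ∑ a + (b x + b y)                ≡⟨ cong (_+ (b x + b y)) (expand a) ⟩
  a x + (a y + rest a) + (b x + b y) ≡⟨ cong (λ r → a x + (a y + r) + (b x + b y)) same-rest ⟩
  a x + (a y + rest b) + (b x + b y) ≡⟨ solve 5 (λ p q r s t → p :+ (q :+ t) :+ (r :+ s) := r :+ (s :+ t) :+ (p :+ q))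
                                              refl (a x) (a y) (b x) (b y) (rest b) ⟩
  b x + (b y + rest b) + (a x + a y) ≡⟨ cong (_+ (a x + a y)) (expand b) ⟨
  ∑ b + (a x + a y)                ∎
  where
  open ≡-Reasoning
  rest : (Fin _ → ℕ) → ℕ
  rest c = ∑ (λ v → if v == y then 0 else (if v == x then 0 else c v))
  expand : ∀ c → ∑ c ≡ c x + (c y + rest c)
  expand c = trans (∑-pick c x) (cong (c x +_) (trans (∑-pick _ y) drop-x))
    where
    drop-x : (if y == x then 0 else c y) + rest c ≡ c y + rest c
    drop-x = cong (λ b → (if b then 0 else c y) + rest c) (==-≢ (x≢y ∘ sym))
  same-rest : rest a ≡ rest b
  same-rest = ∑-rest-cong y outside
    where
    outside : ∀ v → v ≢ y → (if v == x then 0 else a v) ≡ (if v == x then 0 else b v)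
    outside v v≢y with v ≟ x
    ... | yes _   = refl
    ... | no v≢x = a≡b v v≢x v≢y

∑-positive : ∀ {n} {a : Fin n → ℕ} → 0 < ∑ a → ∃ λ k → 0 < a k
∑-positive {n} {a} pos = ∑-<⇒∃< (subst (_< ∑ a) (sym (∑-zero {n} {λ _ → 0} λ _ → refl)) pos)

module _ {n : ℕ} {R : Rel (Fin n) 0ℓ} where

  steps : ∀ {u v} → Star R u v → ℕ
  steps ε       = 0
  steps (_ ◅ p) = suc (steps p)

  vertices : ∀ {u v} → Star R u v → List (Fin n)
  vertices {u} ε       = [ u ]
  vertices {u} (_ ◅ p) = u ∷ vertices p

  All⇒start : ∀ {P : Fin n → Set} {u v} (p : Star R u v) → All P (vertices p) → P u
  All⇒start ε       (pu ∷ _) = pu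
  All⇒start (_ ◅ _) (pu ∷ _) = pu

  private
    open DecMembership (_≟_ {n}) using (_∈?_)

    length-vertices : ∀ {u v} (p : Star R u v) → length (vertices p) ≡ suc (steps p)
    length-vertices ε       = refl
    length-vertices (_ ◅ p) = cong suc (length-vertices p)

    lookup-injective : ∀ {xs : List (Fin n)} → Unique xs → ∀ {i j} → lookup xs i ≡ lookup xs j → i ≡ j
    lookup-injective {x ∷ xs} (x∉ ∷ u) {zero}  {zero}  eq = refl
    lookup-injective {x ∷ xs} (x∉ ∷ _) {zero}  {suc j} eq = contradiction eq (All.lookup x∉ (∈-lookup j))
    lookup-injective {x ∷ xs} (x∉ ∷ _) {suc i} {zero}  eq = contradiction (sym eq) (All.lookup x∉ (∈-lookup i))
    lookup-injective {x ∷ xs} (_ ∷ u)  {suc i} {suc j} eq = cong suc (lookup-injective u eq)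

    suffixFrom : ∀ {a u v} (p : Star R a v) → u ∈ vertices p →
                 Σ (Star R u v) λ q → Unique (vertices p) → Unique (vertices q)
    suffixFrom ε       (here refl) = ε , λ u → u
    suffixFrom (r ◅ p) (here refl) = r ◅ p , λ u → u
    suffixFrom (r ◅ p) (there u∈p) with suffixFrom p u∈p
    ... | q , keep = q , λ { (_ ∷ u) → keep u }

  simplify : ∀ {u v} → Star R u v → Σ (Star R u v) λ q → Unique (vertices q)
  simplify ε = ε , (All.[] ∷ [])
  simplify {u} (r ◅ p) with simplify p
  ... | q , uq with u ∈? vertices q
  ...   | yes u∈q = let (q′ , keep) = suffixFrom q u∈q in q′ , keep uq
  ...   | no  u∉q = r ◅ q , (¬Any⇒All¬ (vertices q) u∉q ∷ uq)

  shortcut : ∀ {u v} → Star R u v → Σ (Star R u v) λ q → steps q < n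
  shortcut p with simplify p
  ... | q , uq = q , subst (_≤ n) (length-vertices q) (injective⇒≤ {f = lookup (vertices q)} (lookup-injective uq))

-- Bounded reachability

data Adj {n} (L : List (Edge n)) (a b : Fin n) : Set where
  fwd : (a , b) ∈ L → Adj L a b
  bwd : (b , a) ∈ L → Adj L a b

Adj-sym : ∀ {n} {L : List (Edge n)} {a b : Fin n} → Adj L a b → Adj L b a
Adj-sym (fwd ab∈L) = bwd ab∈L
Adj-sym (bwd ba∈L) = fwd ba∈L

module _ {n : ℕ} (L : List (Edge n)) where

  private
    ∨-introˡ : ∀ {x y} → T x → T (x ∨ y)
    ∨-introˡ = from T-∨ ∘ inj₁
    ∨-introʳ : ∀ x {y} → T y → T (x ∨ y)
    ∨-introʳ _ = from T-∨ ∘ inj₂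
    ∧-intro : ∀ {x y} → T x → T y → T (x ∧ y)
    ∧-intro tx ty = from T-∧ (tx , ty)
    T-==-refl : ∀ (u : Fin n) → T (u == u)
    T-==-refl u = fromWitness {a? = u ≟ u} refl

  reach-sound : ∀ k {u v} → T (reach L k u v) → Star (Adj L) u v
  reach-sound zero    {u} {v} t with refl ← toWitness {a? = u ≟ v} t = ε
  reach-sound (suc k) {u} {v} t with to T-∨ t
  ... | inj₁ u=v with refl ← toWitness {a? = u ≟ v} u=v = ε
  ... | inj₂ some with find (any⁻ _ L some)
  ... | (a , b) , ab∈L , t′ with to T-∨ t′
  ... | inj₁ t″ with a=u , t‴ ← to T-∧ t″ with refl ← toWitness {a? = a ≟ u} a=u =
    fwd ab∈L ◅ reach-sound k t‴
  ... | inj₂ t″ with b=u , t‴ ← to T-∧ t″ with refl ← toWitness {a? = b ≟ u} b=u =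
    bwd ab∈L ◅ reach-sound k t‴

  reach-complete : ∀ k {u v} (p : Star (Adj L) u v) → steps p ≤ k → T (reach L k u v)
  reach-complete zero    {u} ε _ = T-==-refl u
  reach-complete (suc k) {u} ε _ = ∨-introˡ (T-==-refl u)
  reach-complete (suc k) {u} {v} (fwd ub∈L ◅ p) (s≤s p≤k) =
    ∨-introʳ (u == v) (any⁺ _ (lose ub∈L (∨-introˡ (∧-intro (T-==-refl u) (reach-complete k p p≤k)))))
  reach-complete (suc k) {u} {v} (bwd bu∈L ◅ p) (s≤s p≤k) =
    ∨-introʳ (u == v) (any⁺ _ (lose bu∈L (∨-introʳ _ (∧-intro (T-==-refl u) (reach-complete k p p≤k)))))

  reach-connected : ∀ {u v} → Star (Adj L) u v → T (reach L n u v)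
  reach-connected p with q , q<n ← shortcut p = reach-complete n q (<⇒≤ q<n)

-- Connected graphs on n vertices have at least n − 1 edges

module _ {n : ℕ} where

  open import Data.Fin.Subset
    using (Subset; inside; outside; _⊆_; _∩_; ∁; ⁅_⁆; ∣_∣) renaming (_∈_ to _∈ˢ_)
  open import Data.Fin.Subset.Properties
    using ( _∈?_; ∣⊤∣≡n; ∣⊥∣≡0; ∣⁅x⁆∣≡1; p⊆q⇒∣p∣≤∣q∣; p∩q⊆p; x∈p∩q⁺; x∈p∩q⁻; x∉p⇒x∈∁p; x∈∁p⇒x∉p
          ; ∉⊥; x∈⁅x⁆; nonempty?; Empty-unique )
  import Data.Fin.Subset as Subset
  open import Data.Vec using (_∷_; here; there)

  private
    new-or-old : ∀ {a b : Fin n} {L s s′} → Adj ((a , b) ∷ L) s s′ → (s ≡ a ⊎ s ≡ b) ⊎ Adj L s s′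
    new-or-old (fwd (here refl)) = inj₁ (inj₁ refl)
    new-or-old (bwd (here refl)) = inj₁ (inj₂ refl)
    new-or-old (fwd (there m))   = inj₂ (fwd m)
    new-or-old (bwd (there m))   = inj₂ (bwd m)

  avoids-or-reaches : ∀ {a b : Fin n} {L s t} → Star (Adj ((a , b) ∷ L)) s t →
                      Star (Adj L) s t ⊎ (Star (Adj L) s a ⊎ Star (Adj L) s b)
  avoids-or-reaches ε = inj₁ ε
  avoids-or-reaches (r ◅ p) with new-or-old r
  ... | inj₁ (inj₁ refl) = inj₂ (inj₁ ε)
  ... | inj₁ (inj₂ refl) = inj₂ (inj₂ ε)
  ... | inj₂ r′          = Sum.map (r′ ◅_) (Sum.map (r′ ◅_) (r′ ◅_)) (avoids-or-reaches p)

  Separated : List (Edge n) → Subset n → Set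
  Separated L p = ∀ {u v} → u ∈ˢ p → v ∈ˢ p → Star (Adj L) u v → u ≡ v

  private
    p⊆p∩∁⊥ : ∀ {m} (p : Subset m) → p ⊆ p ∩ ∁ Subset.⊥
    p⊆p∩∁⊥ p x∈p = x∈p∩q⁺ (x∈p , x∉p⇒x∈∁p ∉⊥)

    ∣p∣≤1+∣p∩∁⁅x⁆∣ : ∀ {m} (p : Subset m) x → ∣ p ∣ ≤ suc ∣ p ∩ ∁ ⁅ x ⁆ ∣
    ∣p∣≤1+∣p∩∁⁅x⁆∣ (inside  ∷ p) zero    = s≤s (p⊆q⇒∣p∣≤∣q∣ (p⊆p∩∁⊥ p))
    ∣p∣≤1+∣p∩∁⁅x⁆∣ (outside ∷ p) zero    = m≤n⇒m≤1+n (p⊆q⇒∣p∣≤∣q∣ (p⊆p∩∁⊥ p))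
    ∣p∣≤1+∣p∩∁⁅x⁆∣ (inside  ∷ p) (suc x) = s≤s (∣p∣≤1+∣p∩∁⁅x⁆∣ p x)
    ∣p∣≤1+∣p∩∁⁅x⁆∣ (outside ∷ p) (suc x) = ∣p∣≤1+∣p∩∁⁅x⁆∣ p x

  separated-∷ : ∀ {a b : Fin n} {L p} → Separated L p → (∀ {u} → u ∈ˢ p → ¬ Star (Adj L) u b) →
                Separated ((a , b) ∷ L) p
  separated-∷ sep far {u} {v} u∈p v∈p path
    with avoids-or-reaches path | avoids-or-reaches (reverse Adj-sym path)
  ... | inj₁ u→v         | _                = sep u∈p v∈p u→v
  ... | _                | inj₁ v→u         = sep u∈p v∈p (reverse Adj-sym v→u)
  ... | inj₂ (inj₂ u→b) | _                = contradiction u→b (far u∈p)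
  ... | _                | inj₂ (inj₂ v→b) = contradiction v→b (far v∈p)
  ... | inj₂ (inj₁ u→a) | inj₂ (inj₁ v→a) = sep u∈p v∈p (u→a ◅◅ reverse Adj-sym v→a)

  -- Adding an edge (a , b) costs at most one vertex: the unique one connected to b.
  separated-subset : ∀ L → ∃ λ p → n ≤ ∣ p ∣ + length L × Separated L p
  separated-subset [] = Subset.⊤ , ≤-reflexive (sym (trans (+-identityʳ _) (∣⊤∣≡n n))) , no-edges
    where
    no-edges : Separated [] Subset.⊤
    no-edges _ _ ε               = refl
    no-edges _ _ (fwd () ◅ _)
    no-edges _ _ (bwd () ◅ _)
  separated-subset ((a , b) ∷ L) with separated-subset L
  ... | p , bound , sep with any? (λ r → r ∈? p ×-dec T? (reach L n r b))
  ...   | no none = p , ≤-trans bound (+-monoʳ-≤ ∣ p ∣ (n≤1+n _)) ,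
                    separated-∷ sep (λ u∈p u→b → none (_ , u∈p , reach-connected L u→b))
  ...   | yes (r , r∈p , r→b) = p ∩ ∁ ⁅ r ⁆ , bound′ , separated-∷ sep′ far
    where
    sep′ : Separated L (p ∩ ∁ ⁅ r ⁆)
    sep′ u∈ v∈ = sep (p∩q⊆p p _ u∈) (p∩q⊆p p _ v∈)
    far : ∀ {u} → u ∈ˢ p ∩ ∁ ⁅ r ⁆ → ¬ Star (Adj L) u b
    far {u} u∈ u→b with refl ← sep (p∩q⊆p p _ u∈) r∈p (u→b ◅◅ reverse Adj-sym (reach-sound L n r→b)) =
      x∈∁p⇒x∉p (proj₂ (x∈p∩q⁻ p _ u∈)) (x∈⁅x⁆ r)
    bound′ : n ≤ ∣ p ∩ ∁ ⁅ r ⁆ ∣ + suc (length L)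
    bound′ = ≤-trans bound (≤-trans (+-monoˡ-≤ (length L) (∣p∣≤1+∣p∩∁⁅x⁆∣ p r))
                                    (≤-reflexive (sym (+-suc _ _))))

  connected⇒≤1+length : ∀ L → (∀ u v → Star (Adj L) u v) → n ≤ suc (length L)
  connected⇒≤1+length L connected with separated-subset L
  ... | p , bound , sep = ≤-trans bound (+-monoˡ-≤ (length L) ∣p∣≤1)
    where
    ∣p∣≤1 : ∣ p ∣ ≤ 1
    ∣p∣≤1 with nonempty? p
    ... | no empty = ≤-trans (≤-reflexive (trans (cong ∣_∣ (Empty-unique empty)) (∣⊥∣≡0 n))) z≤n
    ... | yes (r , r∈p) = ≤-trans (p⊆q⇒∣p∣≤∣q∣ p⊆⁅r⁆) (≤-reflexive (∣⁅x⁆∣≡1 r))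
      where
      p⊆⁅r⁆ : ∀ {u} → u ∈ˢ p → u ∈ˢ ⁅ r ⁆
      p⊆⁅r⁆ u∈p with refl ← sep u∈p r∈p (connected _ r) = x∈⁅x⁆ r

-- Sides of a tree edge

∈-removeAt⁻ : ∀ {A : Set} (xs : List A) j {x} → x ∈ removeAt xs j → ∃ λ i → i ≢ j × lookup xs i ≡ x
∈-removeAt⁻ (_ ∷ _)  zero    x∈      = suc (index x∈) , (λ ()) , sym (lookup-index x∈)
∈-removeAt⁻ (_ ∷ _)  (suc j) (here refl) = zero , (λ ()) , refl
∈-removeAt⁻ (_ ∷ xs) (suc j) (there x∈) with i , i≢j , eq ← ∈-removeAt⁻ xs j x∈ =
  suc i , i≢j ∘ suc-injective , eq

∈-removeAt⁺ : ∀ {A : Set} (xs : List A) {i j} → i ≢ j → lookup xs i ∈ removeAt xs j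
∈-removeAt⁺ (_ ∷ _)  {zero}  {zero}  i≢j = contradiction refl i≢j
∈-removeAt⁺ (_ ∷ _)  {suc i} {zero}  _   = ∈-lookup i
∈-removeAt⁺ (_ ∷ _)  {zero}  {suc j} _   = here refl
∈-removeAt⁺ (_ ∷ xs) {suc i} {suc j} i≢j = there (∈-removeAt⁺ xs (i≢j ∘ cong suc))

module Sides {n : ℕ} (T : Tree n) where

  E : List (Edge n)
  E = edges T

  m : ℕ
  m = length E

  endˡ endʳ : Fin m → Fin n
  endˡ i = proj₁ (lookup E i)
  endʳ i = proj₂ (lookup E i)

  Joins : Fin m → Fin n → Fin n → Set
  Joins i u v = (endˡ i ≡ u × endʳ i ≡ v) ⊎ (endˡ i ≡ v × endʳ i ≡ u)

  Joins-sym : ∀ {i u v} → Joins i u v → Joins i v u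
  Joins-sym (inj₁ uv) = inj₂ uv
  Joins-sym (inj₂ vu) = inj₁ vu

  data Step (P : Fin m → Set) (u v : Fin n) : Set where
    via : ∀ i → P i → Joins i u v → Step P u v

  Step-sym : ∀ {P u v} → Step P u v → Step P v u
  Step-sym (via i p j) = via i p (Joins-sym j)

  Path : Fin n → Fin n → Set
  Path = Star (Step λ _ → ⊤)

  Avoiding : Fin m → Fin n → Fin n → Set
  Avoiding j = Star (Step (_≢ j))

  back : ∀ {P u v} → Star (Step P) u v → Star (Step P) v u
  back = reverse Step-sym

  weaken : ∀ {P Q : Fin m → Set} → (∀ {i} → P i → Q i) → ∀ {u v} → Star (Step P) u v → Star (Step Q) u v
  weaken P⇒Q = Star.map λ { (via i p j) → via i (P⇒Q p) j }

  along : ∀ {P} i → P i → Star (Step P) (endˡ i) (endʳ i)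
  along i p = return (via i p (inj₁ (refl , refl)))

  path : ∀ u v → Path u v
  path u v = fromWalk (connected T u v)
    where
    edge : ∀ {a b} → (a , b) ∈ E → Step _ a b
    edge ab∈E = via (index ab∈E) tt (inj₁ (sym (cong proj₁ eq) , sym (cong proj₂ eq)))
      where eq = lookup-index ab∈E
    fromWalk : ∀ {u v} → Walk E u v → Path u v
    fromWalk here        = ε
    fromWalk (fwd e w) = edge e ◅ fromWalk w
    fromWalk (bwd e w) = Step-sym (edge e) ◅ fromWalk w

  avoiding⇒adj : ∀ {j u v} → Avoiding j u v → Star (Adj (removeAt E j)) u v
  avoiding⇒adj = Star.map λ
    { (via i i≢j (inj₁ (refl , refl))) → fwd (∈-removeAt⁺ E i≢j)
    ; (via i i≢j (inj₂ (refl , refl))) → bwd (∈-removeAt⁺ E i≢j) }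

  adj⇒avoiding : ∀ {j u v} → Star (Adj (removeAt E j)) u v → Avoiding j u v
  adj⇒avoiding {j} = Star.map step
    where
    step : ∀ {a b} → Adj (removeAt E j) a b → Step (_≢ j) a b
    step (fwd ab∈) with i , i≢j , refl ← ∈-removeAt⁻ E j ab∈ = via i i≢j (inj₁ (refl , refl))
    step (bwd ba∈) with i , i≢j , refl ← ∈-removeAt⁻ E j ba∈ = via i i≢j (inj₂ (refl , refl))

  side-sound : ∀ j {v} → side T j v ≡ true → Avoiding j (endˡ j) v
  side-sound j eq = adj⇒avoiding (reach-sound (removeAt E j) n (from T-≡ eq))

  side-complete : ∀ j {v} → Avoiding j (endˡ j) v → side T j v ≡ true
  side-complete j p = to T-≡ (reach-connected (removeAt E j) (avoiding⇒adj p))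

  -- Otherwise T minus edge j would be a connected graph on n vertices with n − 2 edges.
  endpoints-separated : ∀ j → ¬ Avoiding j (endˡ j) (endʳ j)
  endpoints-separated j bridge = <-irrefl refl (≤-trans (s≤s n≤m) (≤-reflexive (size T)))
    where
    bypass : ∀ {a b} → Step (λ _ → ⊤) a b → Avoiding j a b
    bypass (via i tt ends) with i ≟ j
    bypass (via i tt (inj₁ (refl , refl))) | yes refl = bridge
    bypass (via i tt (inj₂ (refl , refl))) | yes refl = back bridge
    ... | no i≢j = return (via i i≢j ends)
    n≤m : n ≤ m
    n≤m = subst (n ≤_) (sym (length-removeAt′ E j))
            (connected⇒≤1+length (removeAt E j) λ u v → avoiding⇒adj ((bypass ⋆) (path u v)))

  joined-separated : ∀ {j t w} → Joins j t w → ¬ Avoiding j t w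
  joined-separated (inj₁ (refl , refl)) = endpoints-separated _
  joined-separated (inj₂ (refl , refl)) = endpoints-separated _ ∘ back

  endˡ≢endʳ : ∀ j → endˡ j ≢ endʳ j
  endˡ≢endʳ j eq = endpoints-separated j (subst (Avoiding j (endˡ j)) eq ε)

  side-endˡ : ∀ j → side T j (endˡ j) ≡ true
  side-endˡ j = side-complete j ε

  side-endʳ : ∀ j → side T j (endʳ j) ≡ false
  side-endʳ j with side T j (endʳ j) in eq
  ... | true  = contradiction (side-sound j eq) (endpoints-separated j)
  ... | false = refl

  side-edge : ∀ {i j} → i ≢ j → side T j (endˡ i) ≡ side T j (endʳ i)
  side-edge {i} {j} i≢j with side T j (endˡ i) in eqˡ | side T j (endʳ i) in eqʳ
  ... | true  | true  = refl
  ... | false | false = refl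
  ... | true  | false = trans (sym (side-complete j (side-sound j eqˡ ◅◅ along i i≢j))) eqʳ
  ... | false | true  = trans (sym eqˡ) (side-complete j (side-sound j eqʳ ◅◅ back (along i i≢j)))

  first-use : ∀ {P} k {s t} → Star (Step P) s t →
              Star (Step λ i → P i × i ≢ k) s t ⊎
              (Star (Step λ i → P i × i ≢ k) s (endˡ k) ⊎ Star (Step λ i → P i × i ≢ k) s (endʳ k))
  first-use k ε = inj₁ ε
  first-use k (via i p ends ◅ q) with i ≟ k
  first-use k (via i p (inj₁ (refl , refl)) ◅ q) | yes refl = inj₂ (inj₁ ε)
  first-use k (via i p (inj₂ (refl , refl)) ◅ q) | yes refl = inj₂ (inj₂ ε)
  ... | no i≢k = Sum.map (s ◅_) (Sum.map (s ◅_) (s ◅_)) (first-use k q)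
    where s = via i (p , i≢k) ends

  endpoint-reachable : ∀ j v → Avoiding j (endˡ j) v ⊎ Avoiding j (endʳ j) v
  endpoint-reachable j v with first-use j (path v (endˡ j))
  ... | inj₁ q        = inj₁ (back (weaken proj₂ q))
  ... | inj₂ (inj₁ q) = inj₁ (back (weaken proj₂ q))
  ... | inj₂ (inj₂ q) = inj₂ (back (weaken proj₂ q))

  side-false⇒ : ∀ j {v} → side T j v ≡ false → Avoiding j (endʳ j) v
  side-false⇒ j {v} eq with endpoint-reachable j v
  ... | inj₁ p = contradiction (trans (sym (side-complete j p)) eq) λ ()
  ... | inj₂ p = p

  ⇒side-false : ∀ j {v} → Avoiding j (endʳ j) v → side T j v ≡ false
  ⇒side-false j {v} p with side T j v in eq
  ... | true  = contradiction (side-sound j eq ◅◅ back p) (endpoints-separated j)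
  ... | false = refl

  private
    not-true : ∀ {b} → not b ≡ true → b ≡ false
    not-true {false} _ = refl

  -- across k w is the side of T − k not containing w if w is an endpoint of k, and empty otherwise.
  across : Fin m → Fin n → Fin n → Bool
  across k w v = if w == endˡ k then not (side T k v) else (if w == endʳ k then side T k v else false)

  across-endˡ : ∀ k v → across k (endˡ k) v ≡ not (side T k v)
  across-endˡ k v rewrite ==-refl (endˡ k) = refl

  across-endʳ : ∀ k v → across k (endʳ k) v ≡ side T k v
  across-endʳ k v rewrite ==-≢ (endˡ≢endʳ k ∘ sym) | ==-refl (endʳ k) = refl

  across⇒ : ∀ k w {v} → across k w v ≡ true → ∃ λ o → Joins k w o × Avoiding k o v
  across⇒ k w eq with w ≟ endˡ k
  ... | yes refl = endʳ k , inj₁ (refl , refl) , side-false⇒ k (not-true eq)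
  ... | no _ with w ≟ endʳ k
  ...   | yes refl = endˡ k , inj₂ (refl , refl) , side-sound k eq

  ⇒across : ∀ {k w o v} → Joins k w o → Avoiding k o v → across k w v ≡ true
  ⇒across {k} {v = v} (inj₁ (refl , refl)) p = trans (across-endˡ k v) (cong not (⇒side-false k p))
  ⇒across {k} {v = v} (inj₂ (refl , refl)) p = trans (across-endʳ k v) (side-complete k p)

  across-separated : ∀ k w {v} → across k w v ≡ true → ¬ Avoiding k w v
  across-separated k w eq p with _ , joins , q ← across⇒ k w eq = joined-separated joins (p ◅◅ back q)

  across-self : ∀ k w → across k w w ≡ false
  across-self k w with across k w w in eq
  ... | true  = contradiction ε (across-separated k w eq)
  ... | false = refl

  across-joined : ∀ {j t w} → Joins j t w → across j t w ≡ true
  across-joined joins = ⇒across joins ε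

  across-flip : ∀ {j t w} → Joins j t w → ∀ v → across j w v ≡ not (across j t v)
  across-flip {j} (inj₁ (refl , refl)) v rewrite across-endˡ j v | across-endʳ j v = sym (not-involutive _)
  across-flip {j} (inj₂ (refl , refl)) v rewrite across-endˡ j v | across-endʳ j v = refl

  across-exists : ∀ w v → v ≢ w → ∃ λ k → across k w v ≡ true
  across-exists w v v≢w with simplify (path w v)
  ... | ε , _ = contradiction refl v≢w
  ... | via i tt joins ◅ p , (w∉p ∷ _) = i , ⇒across joins (avoid joins p w∉p)
    where
    shared : ∀ {i a a′ o} → Joins i w o → Joins i a a′ → w ≡ a ⊎ w ≡ a′
    shared (inj₁ (refl , refl)) (inj₁ (eq , _)) = inj₁ eq
    shared (inj₁ (refl , refl)) (inj₂ (eq , _)) = inj₂ eq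
    shared (inj₂ (refl , refl)) (inj₁ (_ , eq)) = inj₂ eq
    shared (inj₂ (refl , refl)) (inj₂ (_ , eq)) = inj₁ eq
    avoid : ∀ {i o a b} → Joins i w o → (p : Path a b) → All (w ≢_) (vertices p) → Avoiding i a b
    avoid joins ε _ = ε
    avoid {i} joins (via i′ tt joins′ ◅ p) (w≢a ∷ w∉p) with i′ ≟ i
    ... | no i′≢i = via i′ i′≢i joins′ ◅ avoid joins p w∉p
    ... | yes refl with shared joins joins′
    ...   | inj₁ w≡a  = contradiction w≡a w≢a
    ...   | inj₂ w≡a′ = contradiction w≡a′ (All⇒start p w∉p)

  private
    through-end : ∀ {j k w o s} → k ≢ j → Joins k w o →
                  Avoiding j s (endˡ k) ⊎ Avoiding j s (endʳ k) → Avoiding j s w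
    through-end _   (inj₁ (refl , refl)) (inj₁ p) = p
    through-end k≢j (inj₁ (refl , refl)) (inj₂ p) = p ◅◅ back (along _ k≢j)
    through-end k≢j (inj₂ (refl , refl)) (inj₁ p) = p ◅◅ along _ k≢j
    through-end _   (inj₂ (refl , refl)) (inj₂ p) = p

  across-unique : ∀ {j k w v} → across j w v ≡ true → across k w v ≡ true → j ≡ k
  across-unique {j} {k} {w} aj ak with j ≟ k
  ... | yes j≡k = j≡k
  ... | no  j≢k with across⇒ j w aj | across⇒ k w ak
  ...   | _ , joins-j , oj→v | _ , joins-k , _ with first-use k oj→v
  ...     | inj₁ q = contradiction (via j j≢k joins-j ◅ weaken proj₂ q) (across-separated k w ak)
  ...     | inj₂ q = contradiction (through-end (j≢k ∘ sym) joins-k (Sum.map (weaken proj₁) (weaken proj₁) q))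
                                   (joined-separated (Joins-sym joins-j))

  partition-at : ∀ w (c : Fin n → ℕ) → c w + ∑ (λ k → sumOn (across k w) c) ≡ ∑ c
  partition-at w c = begin
    c w + ∑ (λ k → sumOn (across k w) c)             ≡⟨ cong₂ _+_ (sym at-w) (∑-comm (λ k v → if across k w v then c v else 0)) ⟩
    ∑ (λ v → if v == w then c v else 0) + ∑ beyond   ≡⟨ sym (∑-distrib-+ _ beyond) ⟩
    ∑ (λ v → (if v == w then c v else 0) + beyond v) ≡⟨ sum-cong-≗ pointwise ⟩
    ∑ c                                              ∎
    where
    open ≡-Reasoning
    beyond : Fin n → ℕ
    beyond v = ∑ (λ k → if across k w v then c v else 0)
    at-w : ∑ (λ v → if v == w then c v else 0) ≡ c w
    at-w = trans (∑-single w λ v v≢w → cong (if_then c v else 0) (==-≢ v≢w))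
                 (cong (if_then c w else 0) (==-refl w))
    pointwise : ∀ v → (if v == w then c v else 0) + beyond v ≡ c v
    pointwise v with v ≟ w
    ... | yes refl =
          trans (cong (c v +_) (∑-zero λ k → cong (if_then c v else 0) (across-self k v))) (+-identityʳ (c v))
    ... | no v≢w with k , ak ← across-exists w v v≢w =
          trans (∑-single k others) (cong (if_then c v else 0) ak)
      where
      others : ∀ k′ → k′ ≢ k → (if across k′ w v then c v else 0) ≡ 0
      others k′ k′≢k with across k′ w v in ak′
      ... | true  = contradiction (across-unique {w = w} ak′ ak) k′≢k
      ... | false = refl

  excess-flip : ∀ {j t w} {c d : Fin n → ℕ} → Joins j t w → ∑ c ≡ ∑ d →
                sumOn (across j t) c < sumOn (across j t) d → sumOn (across j w) d < sumOn (across j w) c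
  excess-flip {j} {t} {w} {c} {d} joins total lt = ≰⇒> λ cʷ≤dʷ → <-irrefl balance (+-mono-<-≤ lt cʷ≤dʷ)
    where
    split : ∀ a → sumOn (across j t) a + sumOn (across j w) a ≡ ∑ a
    split a = sumOn-complement (across j t) (across j w) a (across-flip joins)
    balance : sumOn (across j t) c + sumOn (across j w) c ≡ sumOn (across j t) d + sumOn (across j w) d
    balance = trans (split c) (trans total (sym (split d)))

  across-nested : ∀ {j t w k v} → Joins j t w → k ≢ j → across k w v ≡ true → across j t v ≡ true
  across-nested {j} {t} {w} {k} {v} joins k≢j akv with across j w v in ajv
  ... | true  = contradiction (across-unique {w = w} akv ajv) k≢j
  ... | false = trans (sym (not-involutive _)) (trans (cong not (sym (across-flip joins v))) (cong not ajv))

  card-across-< : ∀ {j t w k} → Joins j t w → k ≢ j → card (across k w) < card (across j t)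
  card-across-< {j} {t} {w} {k} joins k≢j = ∑-mono-< included w strict
    where
    included : ∀ v → (if across k w v then 1 else 0) ≤ (if across j t v then 1 else 0)
    included v with across k w v in akv
    ... | false = z≤n
    ... | true  rewrite across-nested joins k≢j akv = ≤-refl
    strict : (if across k w w then 1 else 0) < (if across j t w then 1 else 0)
    strict rewrite across-self k w | across-joined joins = s≤s z≤n

  branches-≤ : ∀ w {c d : Fin n → ℕ} → ∑ c ≡ ∑ d → d w ≤ c w →
               ∑ (λ k → sumOn (across k w) c) ≤ ∑ (λ k → sumOn (across k w) d)
  branches-≤ w {c} {d} total dʷ≤cʷ = +-cancelˡ-≤ (d w) _ _ (begin
    d w + ∑ (λ k → sumOn (across k w) c) ≤⟨ +-monoˡ-≤ _ dʷ≤cʷ ⟩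
    c w + ∑ (λ k → sumOn (across k w) c) ≡⟨ partition-at w c ⟩
    ∑ c                                  ≡⟨ total ⟩
    ∑ d                                  ≡⟨ partition-at w d ⟨
    d w + ∑ (λ k → sumOn (across k w) d) ∎)
    where open ≤-Reasoning

  -- Beyond t → w lie w itself and the parts beyond the other edges at w, so an excess of d over c
  -- beyond t → w that is not located at w sits beyond one of those edges.
  descend : ∀ {j t w} {c d : Fin n → ℕ} → ∑ c ≡ ∑ d → Joins j t w →
            sumOn (across j t) c < sumOn (across j t) d → d w ≤ c w →
            ∃ λ k → ∃ λ o → Joins k w o × sumOn (across k w) c < sumOn (across k w) d ×
                             card (across k w) < card (across j t)
  descend {j} {t} {w} total joins lt dʷ≤cʷ
    with k , lt-k ← ∑-≤⇒∃< j (branches-≤ w total dʷ≤cʷ) (excess-flip joins total lt)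
    with _ , akv ← sumOn-<⇒∃ {P = across k w} lt-k
    with o , joins-k , _ ← across⇒ k w akv
    = k , o , joins-k , lt-k , card-across-< joins k≢j
    where
    k≢j : k ≢ j
    k≢j refl = <-asym lt-k (excess-flip joins total lt)

ones : ∀ {n} → Coloring n → Fin n → ℕ
ones g v = if isColor1 (g v) then 1 else 0

count1In≡sumOn : ∀ {n} (P : Fin n → Bool) (g : Coloring n) → count1In P g ≡ sumOn P (ones g)
count1In≡sumOn P g = trans (listSum-allFin (λ v → if P v ∧ isColor1 (g v) then 1 else 0)) (sum-cong-≗ pointwise)
  where
  pointwise : ∀ v → (if P v ∧ isColor1 (g v) then 1 else 0) ≡ (if P v then ones g v else 0)
  pointwise v with P v
  ... | true  = refl
  ... | false = refl

module _ {n : ℕ} (g : Coloring n) {x y : Fin n} where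

  swap-atˡ : swap g x y x ≡ g y
  swap-atˡ rewrite ==-refl x = refl

  swap-atʳ : x ≢ y → swap g x y y ≡ g x
  swap-atʳ x≢y rewrite ==-≢ (x≢y ∘ sym) | ==-refl y = refl

  swap-elsewhere : ∀ {v} → v ≢ x → v ≢ y → swap g x y v ≡ g v
  swap-elsewhere v≢x v≢y rewrite ==-≢ v≢x | ==-≢ v≢y = refl

  swap-exchange : ∀ (P : Fin n → Bool) → x ≢ y →
    sumOn P (ones (swap g x y)) + ((if P x then ones g x else 0) + (if P y then ones g y else 0)) ≡
    sumOn P (ones g) + ((if P x then ones g y else 0) + (if P y then ones g x else 0))
  swap-exchange P x≢y = begin
    sumOn P (ones (swap g x y)) + ((if P x then ones g x else 0) + (if P y then ones g y else 0))
      ≡⟨ ∑-exchange x≢y (λ v v≢x v≢y → cong (weigh (P v)) (swap-elsewhere v≢x v≢y)) ⟩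
    sumOn P (ones g) + ((if P x then ones (swap g x y) x else 0) + (if P y then ones (swap g x y) y else 0))
      ≡⟨ cong (sumOn P (ones g) +_) (cong₂ _+_ (cong (weigh (P x)) swap-atˡ) (cong (weigh (P y)) (swap-atʳ x≢y))) ⟩
    sumOn P (ones g) + ((if P x then ones g y else 0) + (if P y then ones g x else 0)) ∎
    where
    open ≡-Reasoning
    weigh : Bool → Fin 2 → ℕ
    weigh b c = if b then (if isColor1 c then 1 else 0) else 0

  swap-within : ∀ (P : Fin n → Bool) → x ≢ y → P x ≡ P y → sumOn P (ones (swap g x y)) ≡ sumOn P (ones g)
  swap-within P x≢y Px≡Py =
    +-cancelʳ-≡ _ _ _ (trans (swap-exchange P x≢y) (cong (sumOn P (ones g) +_) exchanged))
    where
    exchanged : (if P x then ones g y else 0) + (if P y then ones g x else 0) ≡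
                (if P x then ones g x else 0) + (if P y then ones g y else 0)
    exchanged rewrite Px≡Py = +-comm (if P y then ones g y else 0) (if P y then ones g x else 0)

  swap-across : ∀ (P : Fin n → Bool) → x ≢ y → P x ≡ true → P y ≡ false →
                sumOn P (ones (swap g x y)) + ones g x ≡ sumOn P (ones g) + ones g y
  swap-across P x≢y Px Py with swap-exchange P x≢y
  ... | exchange rewrite Px | Py | +-identityʳ (ones g x) | +-identityʳ (ones g y) = exchange

ones-true : ∀ {n} (g : Coloring n) v → isColor1 (g v) ≡ true → ones g v ≡ 1
ones-true _ _ eq rewrite eq = refl

ones-false : ∀ {n} (g : Coloring n) v → isColor1 (g v) ≡ false → ones g v ≡ 0
ones-false _ _ eq rewrite eq = refl

ones≤1 : ∀ {n} (g : Coloring n) v → ones g v ≤ 1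
ones≤1 g v with isColor1 (g v)
... | true  = s≤s z≤n
... | false = z≤n

private
  suc-∣-∣ : ∀ {m n} → n ≤ m → suc ∣ m - n ∣ ≡ ∣ suc m - n ∣
  suc-∣-∣ {zero}  z≤n       = refl
  suc-∣-∣ {suc m} z≤n       = refl
  suc-∣-∣ {suc m} (s≤s n≤m) = suc-∣-∣ n≤m

  suc-∣suc-∣ : ∀ {m n} → m < n → suc ∣ suc m - n ∣ ≡ ∣ m - n ∣
  suc-∣suc-∣ {zero}  (s≤s z≤n)   = refl
  suc-∣suc-∣ {suc m} (s≤s m<n)   = suc-∣suc-∣ m<n

module Descent {n : ℕ} (T : Tree n) (f ft : Coloring n) (balanced : ∑ (ones f) ≡ ∑ (ones ft)) where

  open Sides T

  -- across j w is the side of t.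
  Excess : Fin m → Fin n → Fin n → Set
  Excess j t w = sumOn (across j w) (ones ft) < sumOn (across j w) (ones f)

  count-side : ∀ j (g : Coloring n) → count1In (side T j) g ≡ sumOn (across j (endʳ j)) (ones g)
  count-side j g = trans (count1In≡sumOn (side T j) g)
                         (sum-cong-≗ λ v → cong (if_then ones g v else 0) (sym (across-endʳ j v)))

  module Counts (j : Fin m) where
    a a′ b : ℕ
    a  = count1In (side T j) f
    a′ = count1In (side T j) (swapAlong T j f)
    b  = count1In (side T j) ft

    swap-count : a′ + ones f (endˡ j) ≡ a + ones f (endʳ j)
    swap-count = begin
      a′ + ones f (endˡ j)
        ≡⟨ cong (_+ ones f (endˡ j)) (count1In≡sumOn (side T j) _) ⟩
      sumOn (side T j) (ones (swap f (endˡ j) (endʳ j))) + ones f (endˡ j)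
        ≡⟨ swap-across f (side T j) (endˡ≢endʳ j) (side-endˡ j) (side-endʳ j) ⟩
      sumOn (side T j) (ones f) + ones f (endʳ j)
        ≡⟨ cong (_+ ones f (endʳ j)) (count1In≡sumOn (side T j) f) ⟨
      a + ones f (endʳ j)
        ∎
      where open ≡-Reasoning

  diff-off-edge : ∀ {i j} → i ≢ j → diff T i (swapAlong T j f) ft ≡ diff T i f ft
  diff-off-edge {i} {j} i≢j = cong (λ a → ∣ a - count1In (side T i) ft ∣) (begin
    count1In (side T i) (swapAlong T j f)               ≡⟨ count1In≡sumOn (side T i) _ ⟩
    sumOn (side T i) (ones (swap f (endˡ j) (endʳ j)))
      ≡⟨ swap-within f (side T i) (endˡ≢endʳ j) (side-edge (i≢j ∘ sym)) ⟩
    sumOn (side T i) (ones f)                           ≡⟨ count1In≡sumOn (side T i) f ⟨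
    count1In (side T i) f                               ∎)
    where open ≡-Reasoning

  diff-on-edge : ∀ {j t w} → Joins j t w → Excess j t w → isColor1 (f t) ≡ true → isColor1 (f w) ≡ false →
                 suc (diff T j (swapAlong T j f) ft) ≡ diff T j f ft
  diff-on-edge {j} (inj₁ (refl , refl)) excess token hole =
    trans (suc-∣-∣ (≤-pred (subst (b <_) (sym moved) b<a))) (cong (λ z → ∣ z - b ∣) moved)
    where
    open Counts j
    open ≡-Reasoning
    b<a : b < a
    b<a = subst₂ _<_ (sym (count-side j ft)) (sym (count-side j f)) excess
    moved : suc a′ ≡ a
    moved = begin
      suc a′               ≡⟨ +-comm 1 a′ ⟩
      a′ + 1               ≡⟨ cong (a′ +_) (ones-true f _ token) ⟨
      a′ + ones f (endˡ j) ≡⟨ swap-count ⟩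
      a + ones f (endʳ j)  ≡⟨ cong (a +_) (ones-false f _ hole) ⟩
      a + 0                ≡⟨ +-identityʳ a ⟩
      a                    ∎
  diff-on-edge {j} (inj₂ (refl , refl)) excess token hole =
    trans (cong (λ z → suc ∣ z - b ∣) moved) (suc-∣suc-∣ a<b)
    where
    open Counts j
    open ≡-Reasoning
    a<b : a < b
    a<b = subst₂ _<_ (sym (count-side j f)) (sym (count-side j ft))
                 (excess-flip (inj₁ (refl , refl)) (sym balanced) excess)
    moved : a′ ≡ suc a
    moved = begin
      a′                   ≡⟨ +-identityʳ a′ ⟨
      a′ + 0               ≡⟨ cong (a′ +_) (ones-false f _ hole) ⟨
      a′ + ones f (endˡ j) ≡⟨ swap-count ⟩
      a + ones f (endʳ j)  ≡⟨ cong (a +_) (ones-true f _ token) ⟩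
      a + 1                ≡⟨ +-comm a 1 ⟩
      suc a                ∎

  D≡∑diff : ∀ g → D T g ft ≡ ∑ (λ i → diff T i g ft)
  D≡∑diff g = listSum-allFin (λ i → diff T i g ft)

  D-decreases : ∀ {j t w} → Joins j t w → Excess j t w → isColor1 (f t) ≡ true → isColor1 (f w) ≡ false →
                suc (D T (swapAlong T j f) ft) ≡ D T f ft
  D-decreases {j} joins excess token hole =
    trans (cong suc (D≡∑diff _))
          (trans (∑-suc-at j (λ i → diff-off-edge) (diff-on-edge joins excess token hole)) (sym (D≡∑diff f)))

  TokenAtTail Swappable : Set
  TokenAtTail = ∃ λ j → ∃ λ t → ∃ λ w → Joins j t w × Excess j t w × isColor1 (f t) ≡ true
  Swappable   = ∃ λ j → ∃ λ t → ∃ λ w →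
                Joins j t w × Excess j t w × isColor1 (f t) ≡ true × isColor1 (f w) ≡ false

  to-token : ∀ {j t w} → Acc _<_ (card (across j w)) → Joins j t w → Excess j t w → TokenAtTail
  to-token {j} {t} {w} (acc smaller) joins excess with isColor1 (f t) in colour
  ... | true  = j , t , w , joins , excess , colour
  ... | false =
    case descend (sym balanced) (Joins-sym joins) excess (≤-trans (≤-reflexive (ones-false f t colour)) z≤n) of λ
      { (k , o , joins-k , excess-k , shrinks) → to-token (smaller shrinks) (Joins-sym joins-k) excess-k }

  to-hole : ∀ {j t w} → Acc _<_ (card (across j t)) → Joins j t w → Excess j t w → isColor1 (f t) ≡ true →
            Swappable
  to-hole {j} {t} {w} (acc smaller) joins excess token with isColor1 (f w) in colour
  ... | false = j , t , w , joins , excess , token , colour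
  ... | true  =
    case descend balanced joins (excess-flip (Joins-sym joins) (sym balanced) excess)
                 (≤-trans (ones≤1 ft w) (≤-reflexive (sym (ones-true f w colour)))) of λ
      { (k , o , joins-k , deficit-k , shrinks) →
        to-hole (smaller shrinks) joins-k (excess-flip joins-k balanced deficit-k) colour }

  excess-somewhere : D T f ft ≢ 0 → ∃ λ j → ∃ λ t → ∃ λ w → Joins j t w × Excess j t w
  excess-somewhere D≢0 with j , pos ← ∑-positive (subst (0 <_) (D≡∑diff f) (n≢0⇒n>0 D≢0))
    with <-cmp (count1In (side T j) f) (count1In (side T j) ft)
  ... | tri< a<b _ _ = j , endʳ j , endˡ j , inj₂ (refl , refl) ,
                       excess-flip (inj₂ (refl , refl)) balanced (subst₂ _<_ (count-side j f) (count-side j ft) a<b)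
  ... | tri≈ _ a≡b _ = contradiction pos (<-irrefl (sym (m≡n⇒∣m-n∣≡0 a≡b)))
  ... | tri> _ _ b<a = j , endˡ j , endʳ j , inj₁ (refl , refl) , subst₂ _<_ (count-side j ft) (count-side j f) b<a

  decreasing-swap : D T f ft ≢ 0 → ∃ λ (i : Fin m) → suc (D T (swapAlong T i f) ft) ≡ D T f ft
  decreasing-swap D≢0 =
    case excess-somewhere D≢0 of λ { (_ , _ , _ , joins₀ , excess₀) →
    case to-token (<-wellFounded _) joins₀ excess₀ of λ { (_ , _ , _ , joins₁ , excess₁ , token₁) →
    case to-hole (<-wellFounded _) joins₁ excess₁ token₁ of λ { (j , _ , _ , joins , excess , token , hole) →
    j , D-decreases joins excess token hole }}}

lemma3 : ∀ {n} (T : Tree n) (f ft : Coloring n) →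
           IsPlacement f → IsPlacement ft →
           count1 f ≡ count1 ft →
           D T f ft ≢ 0 →
           ∃ λ (i : Fin (length (edges T))) → suc (D T (swapAlong T i f) ft) ≡ D T f ft
lemma3 T f ft _ _ same =
  Descent.decreasing-swap T f ft (trans (sym (count1In≡sumOn _ f)) (trans same (count1In≡sumOn _ ft)))
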